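{- Let $\mathfrak{F}=\langle W,R\rangle$ be an $\mathbf{S4}$ frame, $n\ge1$, and $x_0,\dots,x_{n-1},a,u,z\in W$. If $u$ strongly unites $z,a$ and $z$ strongly unites $x_0,\dots,x_{n-1}$, then $u$ strongly unites $x_0,\dots,x_{n-1},a$.
   Context: An $\mathbf{S4}$ frame is a set $W$ with a reflexive transitive relation $R$. For $X\subseteq W$: $\mathord{\uparrow}X=\{w:\exists x\in X,\ xRw\}$, $\Diamond X=\{w:\exists x\in X,\ wRx\}$, $\Box X=\{w:\forall v(wRv\Rightarrow v\in X)\}$. For $k\ge1$, $z$ strongly unites $y_0,\dots,y_{k-1}$ if for every $i<k$: $zRy_i$ and $z\in\Box\big(\mathord{\uparrow}\{y_i\}\cup\bigcup_{i'\in k\setminus\{i\}}\Diamond\mathord{\uparrow}\{y_{i'}\}\big)$. -}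

module Defs where

open import Level using (Level; _⊔_; Lift)
open import Data.Nat using (ℕ; zero; suc)
open import Data.Fin using (Fin; zero; suc)
open import Data.Product using (∃; _×_; _,_)
open import Data.Sum using (_⊎_)
open import Relation.Binary.PropositionalEquality using (_≡_; _≢_)
open import Relation.Binary.Definitions using (Reflexive; Transitive)

record S4Frame (a ℓ : Level) : Set (Level.suc (a ⊔ ℓ)) where
  field
    W     : Set a
    R     : W → W → Set ℓ
    refl  : Reflexive R
    trans : Transitive R

module _ {a ℓ : Level} (F : S4Frame a ℓ) where
  open S4Frame F

  Subset : Set (Level.suc (a ⊔ ℓ))
  Subset = W → Set (a ⊔ ℓ)

  up : Subset → Subset
  up X w = ∃ λ x → X x × R x w

  dia : Subset → Subset
  dia X w = ∃ λ x → X x × R w x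

  box : Subset → Subset
  box X w = ∀ v → R w v → X v

  single : W → Subset
  single y w = Lift (a ⊔ ℓ) (w ≡ y)

  -- z strongly unites y₀,…,y_{k-1} (k ≥ 1, enforced by Fin (suc k)):
  -- for every i, z R yᵢ and z ∈ □( ↑{yᵢ} ∪ ⋃_{i' ≠ i} ◇↑{y_{i'}} ).
  StronglyUnites : {k : ℕ} → W → (Fin (suc k) → W) → Set (a ⊔ ℓ)
  StronglyUnites {k} z y =
    (i : Fin (suc k)) →
      R z (y i) ×
      box (λ v → up (single (y i)) v
                 ⊎ (∃ λ i' → (i' ≢ i) × dia (up (single (y i'))) v)) z

snoc : {b : Level} {A : Set b} → {n : ℕ} → (Fin n → A) → A → Fin (suc n) → A
snoc {n = zero}  x a zero    = a
snoc {n = suc n} x a zero    = x zero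
snoc {n = suc n} x a (suc i) = snoc (λ j → x (suc j)) a i

pair : {b : Level} {A : Set b} → A → A → Fin 2 → A
pair z a zero       = z
pair z a (suc zero) = a

{-# OPTIONS --safe #-}
-- Old index j: u R z R xⱼ, and a successor of u lies either above z, where z strongly uniting
-- the xᵢ applies, or in ◇↑{a}, which is now ◇↑ of another index. New index a: a successor
-- v of u not above a sees some successor w of z; w lies in ◇↑{xᵢ} for some i because z strongly
-- unites the xᵢ, and ◇↑{xᵢ} is closed under R-predecessors by transitivity, so v is in it too.
module Submission where

open import Defs
open import Level using (Level; _⊔_; lift)
open import Function using (_∘_)
open import Data.Nat using (ℕ; zero; suc)
open import Data.Fin using (Fin; zero; suc; inject₁; fromℕ)
open import Data.Fin.Properties using (fromℕ≢inject₁; inject₁-injective)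
open import Data.Fin.Relation.Unary.Top using (view; ‵fromℕ; ‵inject₁)
open import Data.Product using (∃; _×_; _,_; proj₁; proj₂)
open import Data.Sum using (_⊎_; inj₁; inj₂)
open import Data.Empty using (⊥-elim)
open import Relation.Binary.PropositionalEquality using (_≡_; _≢_; refl; sym; subst)

snoc-inject₁ : ∀ {b} {A : Set b} {n} (x : Fin n → A) (a : A) (j : Fin n) →
               snoc x a (inject₁ j) ≡ x j
snoc-inject₁ x a zero    = refl
snoc-inject₁ x a (suc j) = snoc-inject₁ (x ∘ suc) a j

snoc-fromℕ : ∀ {b} {A : Set b} {n} (x : Fin n → A) (a : A) → snoc x a (fromℕ n) ≡ a
snoc-fromℕ {n = zero}  x a = refl
snoc-fromℕ {n = suc n} x a = snoc-fromℕ (x ∘ suc) a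

module _ {a ℓ : Level} (F : S4Frame a ℓ) where
  open S4Frame F using (W; R) renaming (refl to R-refl; trans to R-trans)

  private variable
    k       : ℕ
    u v w y : W

  ↑[_] : W → Subset F
  ↑[ y ] = up F (single F y)

  ◇↑[_] : W → Subset F
  ◇↑[ y ] = dia F ↑[ y ]

  Guarded : (Fin (suc k) → W) → Fin (suc k) → Subset F
  Guarded y i v = ↑[ y i ] v ⊎ ∃ λ i' → i' ≢ i × ◇↑[ y i' ] v

  -- StronglyUnites F z y is definitionally ∀ i → UnitesAt z y i.
  UnitesAt : W → (Fin (suc k) → W) → Fin (suc k) → Set (a ⊔ ℓ)
  UnitesAt z y i = R z (y i) × box F (Guarded y i) z

  ↑-single⁻ : ↑[ y ] w → R y w
  ↑-single⁻ (_ , lift refl , yRw) = yRw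

  ↑⊆◇↑ : ↑[ y ] w → ◇↑[ y ] w
  ↑⊆◇↑ p = _ , p , R-refl

  ◇↑-downClosed : R v w → ◇↑[ y ] w → ◇↑[ y ] v
  ◇↑-downClosed vRw (t , p , wRt) = t , p , R-trans vRw wRt

  successor-of-uniter-∈◇↑ : ∀ {z} {x : Fin (suc k) → W} →
                            StronglyUnites F z x → R z w → ∃ λ i → ◇↑[ x i ] w
  successor-of-uniter-∈◇↑ z-x zRw with proj₂ (z-x zero) _ zRw
  ... | inj₁ p           = zero , ↑⊆◇↑ p
  ... | inj₂ (i , _ , d) = i , d

  module _ {m : ℕ} (x : Fin (suc m) → W) (xa z : W)
           (u-za : StronglyUnites F u (pair z xa)) (z-x : StronglyUnites F z x) where

    ◇↑-old⇒guarded : ∀ {i j} → inject₁ j ≢ i → ◇↑[ x j ] v → Guarded (snoc x xa) i v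
    ◇↑-old⇒guarded {v = v} {j = j} j≢i d =
      inj₂ (inject₁ j , j≢i , subst (λ y → ◇↑[ y ] v) (sym (snoc-inject₁ x xa j)) d)

    ◇↑-new⇒guarded : ∀ {i} → fromℕ (suc m) ≢ i → ◇↑[ xa ] v → Guarded (snoc x xa) i v
    ◇↑-new⇒guarded {v = v} new≢i d =
      inj₂ (fromℕ (suc m) , new≢i , subst (λ y → ◇↑[ y ] v) (sym (snoc-fromℕ x xa)) d)

    unites-old : ∀ j → UnitesAt u (snoc x xa) (inject₁ j)
    unites-old j =
        R-trans (proj₁ (u-za zero)) (subst (R z) (sym (snoc-inject₁ x xa j)) (proj₁ (z-x j)))
      , guarded
      where
      guarded : box F (Guarded (snoc x xa) (inject₁ j)) u
      guarded v uRv with proj₂ (u-za zero) v uRv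
      ... | inj₂ (zero , 0≢0 , _)   = ⊥-elim (0≢0 refl)
      ... | inj₂ (suc zero , _ , d) = ◇↑-new⇒guarded fromℕ≢inject₁ d
      ... | inj₁ p with proj₂ (z-x j) v (↑-single⁻ p)
      ...   | inj₁ q                = inj₁ (subst (λ y → ↑[ y ] v) (sym (snoc-inject₁ x xa j)) q)
      ...   | inj₂ (j' , j'≢j , d)  = ◇↑-old⇒guarded (j'≢j ∘ inject₁-injective) d

    unites-new : UnitesAt u (snoc x xa) (fromℕ (suc m))
    unites-new = subst (R u) (sym (snoc-fromℕ x xa)) (proj₁ (u-za (suc zero))) , guarded
      where
      guarded : box F (Guarded (snoc x xa) (fromℕ (suc m))) u
      guarded v uRv with proj₂ (u-za (suc zero)) v uRv
      ... | inj₁ p                    = inj₁ (subst (λ y → ↑[ y ] v) (sym (snoc-fromℕ x xa)) p)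
      ... | inj₂ (suc zero , 1≢1 , _) = ⊥-elim (1≢1 refl)
      ... | inj₂ (zero , _ , w , p , vRw) with successor-of-uniter-∈◇↑ z-x (↑-single⁻ p)
      ...   | i , d                      = ◇↑-old⇒guarded (fromℕ≢inject₁ ∘ sym) (◇↑-downClosed vRw d)

lemma3 : {a ℓ : Level} (F : S4Frame a ℓ) (m : ℕ) (x : Fin (suc m) → S4Frame.W F) (xa u z : S4Frame.W F) →
    StronglyUnites F u (pair z xa) →
    StronglyUnites F z x →
    StronglyUnites F u (snoc x xa)
lemma3 F m x xa u z u-za z-x i with view i
... | ‵fromℕ     = unites-new F x xa z u-za z-x
... | ‵inject₁ j  = unites-old F x xa z u-za z-x j
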